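{- ${\rm ch}_i(K_4)\le 6$.
   Context: $K_4$ is the complete graph on 4 vertices. An incidence of a graph $G$ is a pair $(v,e)$ with $v$ a vertex and $e$ an edge incident with $v$, written $(v,vu)$ when $e=vu$. Two incidences $(v,e)$, $(w,f)$ are adjacent if $v=w$, or $e=f$, or the edge $vw$ equals $e$ or $f$. For a list assignment $L$ (a finite set $L(v,e)$ of colours for each incidence), $G$ is $L$-list incidence colourable if there is a map $\sigma$ with $\sigma(v,e)\in L(v,e)$ and adjacent incidences receiving distinct colours. ${\rm ch}_i(G)$ is the least $k$ such that $G$ is $L$-list incidence colourable for every $L$ with all lists of size $k$. -}

module Defs where

open import Data.Nat using (ℕ; _≤_)
open import Data.Fin using (Fin)
open import Data.Product using (Σ; _×_; _,_; proj₁; ∃-syntax)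
open import Data.Sum using (_⊎_)
open import Relation.Binary.PropositionalEquality using (_≡_; refl; sym)
open import Relation.Nullary using (¬_)
open import Function.Definitions using (Injective)

record Graph (n : ℕ) : Set₁ where
  field
    Adj   : Fin n → Fin n → Set
    Adj-sym : ∀ {u v} → Adj u v → Adj v u
    Adj-irr : ∀ {v} → ¬ Adj v v
open Graph public

K : (n : ℕ) → Graph n
K n = record { Adj = λ u v → ¬ u ≡ v
             ; Adj-sym = λ p q → p (sym q)
             ; Adj-irr = λ p → p refl }

K₄ : Graph 4
K₄ = K 4

-- An incidence (v, vu): vertex v together with the edge vu, identified by its other end u.
Incidence : ∀ {n} → Graph n → Set
Incidence {n} G = Σ (Fin n) λ v → Σ (Fin n) λ u → Adj G v u

vtx : ∀ {n} {G : Graph n} → Incidence G → Fin n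
vtx (v , _ , _) = v

other : ∀ {n} {G : Graph n} → Incidence G → Fin n
other (_ , u , _) = u

SameEdge : ∀ {n} → Fin n → Fin n → Fin n → Fin n → Set
SameEdge v u w x = (v ≡ w × u ≡ x) ⊎ (v ≡ x × u ≡ w)

-- (v, vu) and (w, wx) are adjacent iff v = w, or vu = wx, or the edge vw equals vu or wx.
AdjInc : ∀ {n} {G : Graph n} → Incidence G → Incidence G → Set
AdjInc (v , u , _) (w , x , _) =
  v ≡ w ⊎ SameEdge v u w x ⊎ SameEdge v w v u ⊎ SameEdge v w w x

ListAssignment : ∀ {n} → Graph n → ℕ → Set
ListAssignment G k = Incidence G → Σ (Fin k → ℕ) Injective'
  where Injective' : (Fin k → ℕ) → Set
        Injective' f = Injective _≡_ _≡_ f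

InList : ∀ {n} {G : Graph n} {k} → ListAssignment G k → Incidence G → ℕ → Set
InList L i c = ∃[ j ] (proj₁ (L i) j ≡ c)

-- G is L-list incidence colourable. Distinct incidences = distinct (v,u) pairs
-- (the adjacency proof component is irrelevant to identity).
ListIncColourable : ∀ {n} (G : Graph n) {k} → ListAssignment G k → Set
ListIncColourable G L =
  Σ (Incidence G → ℕ) λ σ →
    (∀ i → InList {G = G} L i (σ i)) ×
    (∀ i j → AdjInc {G = G} i j →
       ¬ (vtx {G = G} i ≡ vtx {G = G} j × other {G = G} i ≡ other {G = G} j) →
       ¬ σ i ≡ σ j)

IncChoosable : ∀ {n} → Graph n → ℕ → Set
IncChoosable G k = ∀ (L : ListAssignment G k) → ListIncColourable G L

-- ch_i(G) ≤ m : the least k with G k-incidence-choosable is at most m,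
-- i.e. some k ≤ m makes G k-incidence-choosable.
chᵢ≤ : ∀ {n} → Graph n → ℕ → Set
chᵢ≤ G m = ∃[ k ] (k ≤ m × IncChoosable G k)

-- Pair each arc (v , u) of K₄ with an arc on the complementary edge; mated incidences are
-- never adjacent, so the incidence graph of K₄ is a subgraph of the cocktail-party graph
-- K₂,₂,₂,₂,₂,₂, which is 6-choosable (Erdős–Rubin–Taylor).  For n pairs with lists of size
-- n: if some pair shares a colour, give it to both ends, delete it from all other lists and
-- recurse on the other n - 1 pairs.  Otherwise the two lists of each pair are disjoint, so a
-- set X of vertices containing a whole pair sees at least 2n ≥ |X| colours, while a set
-- containing no pair has at most n elements; Hall's condition holds, and Hall's theorem
-- (proved by the Halmos–Vaughan induction on critical sets) gives all vertices distinct colours.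
module Submission where

open import Defs

open import Data.Nat using (ℕ; suc; _+_; _≤_; _<_; z≤n; s≤s; _≤?_; _<?_)
open import Data.Nat.Properties
  using ( ≤-refl; ≤-trans; ≤-reflexive; ≤-<-trans; <-≤-trans; ≤-pred; ≰⇒>; 1+n≰n
        ; +-mono-≤; +-monoʳ-≤; +-monoˡ-≤; +-cancelˡ-≤; +-suc; module ≤-Reasoning)
  renaming (_≟_ to _≟ℕ_)
open import Data.List
  using (List; []; _∷_; [_]; _++_; length; filter; map; concatMap; deduplicate; tabulate)
open import Data.List.Properties
  using (length-filter; filter-notAll; filter-some; length-++; length-map; length-tabulate)
open import Data.List.Membership.Propositional using (_∈_; _∉_; find; lose)
open import Data.List.Membership.Propositional.Properties
  using ( ∈-filter⁺; ∈-filter⁻; ∈-++⁺ˡ; ∈-++⁺ʳ; ∈-++⁻; ∈-map⁺; ∈-map⁻; ∈-concatMap⁺; ∈-concatMap⁻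
        ; ∈-deduplicate⁺; ∈-deduplicate⁻; ∈-tabulate⁻)
open import Data.List.Membership.DecPropositional _≟ℕ_ using () renaming (_∈?_ to _∈ℕ?_)
open import Data.List.Relation.Unary.Any using (Any; here; there; any?)
open import Data.List.Relation.Unary.All as All using (All; []; _∷_)
open import Data.List.Relation.Unary.AllPairs using ([]; _∷_)
open import Data.List.Relation.Unary.Unique.Propositional using (Unique)
import Data.List.Relation.Unary.Unique.Propositional.Properties as Unique
open import Data.List.Relation.Unary.Unique.DecPropositional.Properties _≟ℕ_
  using () renaming (deduplicate-! to Unique-deduplicateℕ)
open import Data.List.Relation.Binary.Subset.Propositional using (_⊆_)
open import Data.List.Relation.Binary.Disjoint.Propositional using (Disjoint)
open import Data.Product using (Σ; ∃; _×_; _,_; proj₁; proj₂; map₁; map₂)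
open import Data.Product.Properties using (≡-dec)
open import Data.Fin using (Fin; #_)
open import Data.Fin.Properties using () renaming (_≟_ to _≟F_; all? to allFin?)
open import Data.Sum using (_⊎_; inj₁; inj₂) renaming (map to ⊎-map)
open import Data.Empty using (⊥-elim)
open import Function using (_∘_; const; id)
open import Relation.Nullary using (¬_; Dec; yes; no; ¬?)
open import Relation.Nullary.Decidable using (_×-dec_; _⊎-dec_; toWitness)
open import Relation.Unary using (Decidable)
open import Relation.Binary.PropositionalEquality using (_≡_; _≢_; refl; sym; subst; cong)
open import Relation.Binary.Definitions using (DecidableEquality)

module _ {A : Set} (_≟_ : DecidableEquality A) where

  Unique-⊆⇒length≤ : ∀ {xs ys : List A} → Unique xs → xs ⊆ ys → length xs ≤ length ys
  Unique-⊆⇒length≤ {[]} _ _ = z≤n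
  Unique-⊆⇒length≤ {x ∷ xs} {ys} (x∉xs ∷ !xs) x∷xs⊆ys =
    ≤-<-trans (Unique-⊆⇒length≤ !xs xs⊆ys-x) (filter-notAll x≢? ys x∈ys)
    where
      x≢? : Decidable (x ≢_)
      x≢? y = ¬? (x ≟ y)
      xs⊆ys-x : xs ⊆ filter x≢? ys
      xs⊆ys-x y∈xs = ∈-filter⁺ x≢? (x∷xs⊆ys (there y∈xs)) (All.lookup x∉xs y∈xs)
      x∈ys : Any (λ y → ¬ ¬ (x ≡ y)) ys
      x∈ys = lose (x∷xs⊆ys (here refl)) (λ x≢x → x≢x refl)

Unique-map⁺-injectiveOn : ∀ {A B : Set} (f : A → B) {xs} → Unique xs →
  (∀ {u w} → u ∈ xs → w ∈ xs → u ≢ w → f u ≢ f w) → Unique (map f xs)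
Unique-map⁺-injectiveOn f {[]} _ _ = []
Unique-map⁺-injectiveOn f {x ∷ xs} (x∉xs ∷ !xs) injective =
  All.tabulate fx∉ ∷ Unique-map⁺-injectiveOn f !xs (λ u∈ w∈ → injective (there u∈) (there w∈))
  where
    fx∉ : ∀ {z} → z ∈ map f xs → f x ≢ z
    fx∉ z∈ with ∈-map⁻ f z∈
    ... | u , u∈xs , refl = injective (here refl) (there u∈xs) (All.lookup x∉xs u∈xs)

avoiding : List ℕ → List ℕ → List ℕ
avoiding C = filter (λ d → ¬? (d ∈ℕ? C))

∈-avoiding⁺ : ∀ {C l d} → d ∈ l → d ∉ C → d ∈ avoiding C l
∈-avoiding⁺ {C} = ∈-filter⁺ (λ d → ¬? (d ∈ℕ? C))

∈-avoiding⁻ : ∀ C l {d} → d ∈ avoiding C l → d ∈ l × d ∉ C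
∈-avoiding⁻ C l = ∈-filter⁻ (λ d → ¬? (d ∈ℕ? C)) {xs = l}

infixr 5 _∪_
_∪_ : List ℕ → List ℕ → List ℕ
C ∪ l = C ++ avoiding C l

∈-∪⁺ : ∀ {C l d} → d ∈ C ⊎ d ∈ l → d ∈ C ∪ l
∈-∪⁺ (inj₁ d∈C) = ∈-++⁺ˡ d∈C
∈-∪⁺ {C} {l} {d} (inj₂ d∈l) with d ∈ℕ? C
... | yes d∈C = ∈-++⁺ˡ d∈C
... | no d∉C = ∈-++⁺ʳ C (∈-avoiding⁺ d∈l d∉C)

Unique-∪ : ∀ {C l} → Unique C → Unique l → Unique (C ∪ l)
Unique-∪ {C} {l} !C !l = Unique.++⁺ !C (Unique.filter⁺ (λ d → ¬? (d ∈ℕ? C)) !l)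
  λ (d∈C , d∈rest) → proj₂ (∈-avoiding⁻ C l d∈rest) d∈C

length-∪ : ∀ C l → length (C ∪ l) ≤ length C + length l
length-∪ C l = ≤-trans (≤-reflexive (length-++ C)) (+-monoʳ-≤ (length C) (length-filter _ l))

avoiding⊆⇒⊆∪ : ∀ C {l m} → avoiding C l ⊆ m → l ⊆ C ∪ m
avoiding⊆⇒⊆∪ C {m = m} rest⊆m {d} d∈l with d ∈ℕ? C
... | yes d∈C = ∈-∪⁺ {l = m} (inj₁ d∈C)
... | no d∉C = ∈-∪⁺ (inj₂ (rest⊆m (∈-avoiding⁺ d∈l d∉C)))

length≤1+avoiding : ∀ c {l} → Unique l → length l ≤ suc (length (avoiding [ c ] l))
length≤1+avoiding c {l} !l =
  ≤-trans (Unique-⊆⇒length≤ _≟ℕ_ !l (avoiding⊆⇒⊆∪ [ c ] id)) (length-∪ [ c ] (avoiding [ c ] l))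

Colouring : {A : Set} → (A → A → Set) → (A → List ℕ) → (A → Set) → Set
Colouring {A} _#_ L D =
  Σ (A → ℕ) λ σ → (∀ {v} → D v → σ v ∈ L v) × (∀ {v w} → D v → D w → v # w → σ v ≢ σ w)

module _ {A : Set} {_#_ : A → A → Set} {L : A → List ℕ} where

  colouring-mono : ∀ {_#′_ : A → A → Set} {D D′ : A → Set} →
    (∀ {v} → D′ v → D v) → (∀ {v w} → v #′ w → v # w) → Colouring _#_ L D → Colouring _#′_ L D′
  colouring-mono D′⊆D #′⇒# (σ , σ∈L , proper) =
    σ , σ∈L ∘ D′⊆D , λ v∈ w∈ v#w → proper (D′⊆D v∈) (D′⊆D w∈) (#′⇒# v#w)

  colouring-glue : ∀ {D P : A → Set} → Decidable P → (C : List ℕ) →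
    (σ₁ : Colouring _#_ L (λ v → D v × P v)) → (∀ {v} → D v → P v → proj₁ σ₁ v ∈ C) →
    Colouring _#_ (avoiding C ∘ L) (λ v → D v × ¬ P v) → Colouring _#_ L D
  colouring-glue {D} {P} P? C (σ₁ , σ₁∈L , proper₁) σ₁∈C (σ₂ , σ₂∈ , proper₂) = σ , σ∈L , proper
    where
      σ₂∉C : ∀ {v} → D v → ¬ P v → σ₂ v ∉ C
      σ₂∉C {v} v∈ ¬p = proj₂ (∈-avoiding⁻ C (L v) (σ₂∈ (v∈ , ¬p)))

      σ : A → ℕ
      σ v with P? v
      ... | yes _ = σ₁ v
      ... | no _ = σ₂ v

      σ∈L : ∀ {v} → D v → σ v ∈ L v
      σ∈L {v} v∈ with P? v
      ... | yes p = σ₁∈L (v∈ , p)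
      ... | no ¬p = proj₁ (∈-avoiding⁻ C (L v) (σ₂∈ (v∈ , ¬p)))

      proper : ∀ {v w} → D v → D w → v # w → σ v ≢ σ w
      proper {v} {w} v∈ w∈ v#w with P? v | P? w
      ... | yes p | yes q = proper₁ (v∈ , p) (w∈ , q) v#w
      ... | no ¬p | no ¬q = proper₂ (v∈ , ¬p) (w∈ , ¬q) v#w
      ... | yes p | no ¬q = λ eq → σ₂∉C w∈ ¬q (subst (_∈ C) eq (σ₁∈C v∈ p))
      ... | no ¬p | yes q = λ eq → σ₂∉C v∈ ¬p (subst (_∈ C) (sym eq) (σ₁∈C w∈ q))

module Hall {A : Set} (_≟_ : DecidableEquality A) where
  open import Data.List.Membership.DecPropositional _≟_ using (_∈?_)
  open import Data.List.Relation.Unary.Unique.DecPropositional.Properties _≟_ using (deduplicate-!)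

  Covers : (A → List ℕ) → List A → List ℕ → Set
  Covers L xs cs = ∀ {v} → v ∈ xs → L v ⊆ cs

  -- |N(X)| ≥ |X| for X ⊆ vs, phrased without computing N(X): every duplicate-free colour
  -- list covering the lists of X is at least as long as X.
  HallCondition : (A → List ℕ) → List A → Set
  HallCondition L vs =
    ∀ xs cs → Unique xs → xs ⊆ vs → Unique cs → Covers L xs cs → length xs ≤ length cs

  SDR : (A → List ℕ) → List A → Set
  SDR L vs = Colouring _≢_ L (_∈ vs)

  HallCondition-⊆ : ∀ {L ys vs} → ys ⊆ vs → HallCondition L vs → HallCondition L ys
  HallCondition-⊆ ys⊆vs hall xs cs !xs xs⊆ys = hall xs cs !xs (ys⊆vs ∘ xs⊆ys)

  hall⇒nonempty : ∀ {L vs v} → HallCondition L vs → v ∈ vs → ∃ (_∈ L v)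
  hall⇒nonempty {L} {v = v} hall v∈vs with L v in eq
  ... | c ∷ _ = c , here refl
  ... | [] = ⊥-elim (1+n≰n (hall [ v ] [] ([] ∷ []) (λ { (here refl) → v∈vs }) []
                                 (λ { (here refl) d∈ → subst (_ ∈_) eq d∈ })))

  infixl 5 _∖_
  _∖_ : List A → List A → List A
  vs ∖ X = filter (λ w → ¬? (w ∈? X)) vs

  length-∖ : ∀ {vs X} → X ⊆ vs → 0 < length X → length (vs ∖ X) < length vs
  length-∖ {vs} {x ∷ X} X⊆vs _ =
    filter-notAll (λ w → ¬? (w ∈? (x ∷ X))) vs (lose (X⊆vs (here refl)) (λ x∉X → x∉X (here refl)))

  sublists : List A → List (List A)
  sublists [] = [ [] ]
  sublists (x ∷ xs) = map (x ∷_) (sublists xs) ++ sublists xs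

  sublists-⊆ : ∀ vs {X} → X ∈ sublists vs → X ⊆ vs
  sublists-⊆ [] (here refl) ()
  sublists-⊆ (x ∷ vs) X∈ with ∈-++⁻ (map (x ∷_) (sublists vs)) X∈
  ... | inj₂ X∈′ = there ∘ sublists-⊆ vs X∈′
  ... | inj₁ x∷Y∈ with ∈-map⁻ (x ∷_) x∷Y∈
  ...   | Y , Y∈ , refl = λ { (here refl) → here refl ; (there y∈Y) → there (sublists-⊆ vs Y∈ y∈Y) }

  Unique-sublists : ∀ {vs X} → Unique vs → X ∈ sublists vs → Unique X
  Unique-sublists {[]} _ (here refl) = []
  Unique-sublists {x ∷ vs} (x∉vs ∷ !vs) X∈ with ∈-++⁻ (map (x ∷_) (sublists vs)) X∈
  ... | inj₂ X∈′ = Unique-sublists !vs X∈′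
  ... | inj₁ x∷Y∈ with ∈-map⁻ (x ∷_) x∷Y∈
  ...   | Y , Y∈ , refl = All.tabulate (All.lookup x∉vs ∘ sublists-⊆ vs Y∈) ∷ Unique-sublists !vs Y∈

  filter∈sublists : ∀ {P : A → Set} (P? : Decidable P) vs → filter P? vs ∈ sublists vs
  filter∈sublists P? [] = here refl
  filter∈sublists P? (x ∷ vs) with P? x
  ... | yes _ = ∈-++⁺ˡ (∈-map⁺ (x ∷_) (filter∈sublists P? vs))
  ... | no _ = ∈-++⁺ʳ (map (x ∷_) (sublists vs)) (filter∈sublists P? vs)

  colours : (A → List ℕ) → List A → List ℕ
  colours L X = deduplicate _≟ℕ_ (concatMap L X)

  Unique-colours : ∀ L X → Unique (colours L X)
  Unique-colours L X = Unique-deduplicateℕ (concatMap L X)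

  ∈-colours⁺ : ∀ {L X v d} → v ∈ X → d ∈ L v → d ∈ colours L X
  ∈-colours⁺ {L} v∈X d∈ = ∈-deduplicate⁺ _≟ℕ_ (∈-concatMap⁺ L (lose v∈X d∈))

  ∈-colours⁻ : ∀ L X {d} → d ∈ colours L X → ∃ λ v → v ∈ X × d ∈ L v
  ∈-colours⁻ L X d∈ = find (∈-concatMap⁻ L {xs = X} (∈-deduplicate⁻ _≟ℕ_ (concatMap L X) d∈))

  -- Under Hall's condition the inequality is an equality: X is critical in the Halmos–Vaughan sense.
  Critical : (A → List ℕ) → List A → List A → Set
  Critical L vs X = 0 < length X × length X < length vs × length (colours L X) ≤ length X

  critical? : ∀ L vs → Decidable (Critical L vs)
  critical? L vs X =
    (0 <? length X) ×-dec (length X <? length vs) ×-dec (length (colours L X) ≤? length X)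

  -- A nonempty xs ⊆ vs is non-critical in v ∷ vs, so it has a surplus colour that pays for c.
  hall-avoiding-colour : ∀ {L v vs} c → v ∉ vs → HallCondition L (v ∷ vs) →
    ¬ Any (Critical L (v ∷ vs)) (sublists (v ∷ vs)) → HallCondition (avoiding [ c ] ∘ L) vs
  hall-avoiding-colour c _ _ _ [] _ _ _ _ _ = z≤n
  hall-avoiding-colour {L} {v} {vs} c v∉vs hall noCritical xs@(x ∷ _) cs !xs xs⊆vs !cs covers =
    ≤-pred (begin-strict
      length xs               ≤⟨ Unique-⊆⇒length≤ _≟_ !xs xs⊆X ⟩
      length X                <⟨ ≰⇒> X-not-critical ⟩
      length (colours L X)    ≤⟨ Unique-⊆⇒length≤ _≟ℕ_ (Unique-colours L X) coloursX⊆ ⟩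
      length ([ c ] ∪ cs)     ≤⟨ length-∪ [ c ] cs ⟩
      suc (length cs)         ∎)
    where
      open ≤-Reasoning
      ∈xs? : Decidable (_∈ xs)
      ∈xs? = _∈? xs
      X : List A
      X = filter ∈xs? (v ∷ vs)
      xs⊆X : xs ⊆ X
      xs⊆X y∈xs = ∈-filter⁺ ∈xs? (there (xs⊆vs y∈xs)) y∈xs
      X-not-critical : ¬ length (colours L X) ≤ length X
      X-not-critical tight = noCritical (lose (filter∈sublists ∈xs? (v ∷ vs))
        ( filter-some ∈xs? (lose (there (xs⊆vs (here refl))) (here refl))
        , filter-notAll ∈xs? (v ∷ vs) (here (v∉vs ∘ xs⊆vs))
        , tight ))
      coloursX⊆ : colours L X ⊆ [ c ] ∪ cs
      coloursX⊆ d∈ with ∈-colours⁻ L X d∈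
      ... | y , y∈X , d∈Ly = avoiding⊆⇒⊆∪ [ c ] (covers (proj₂ (∈-filter⁻ ∈xs? {xs = v ∷ vs} y∈X))) d∈Ly

  hall-avoiding-critical : ∀ {L vs X} → Unique X → X ⊆ vs → length (colours L X) ≤ length X →
    HallCondition L vs → HallCondition (avoiding (colours L X) ∘ L) (vs ∖ X)
  hall-avoiding-critical {L} {vs} {X} !X X⊆vs tight hall zs ds !zs zs⊆vs∖X !ds covers =
    +-cancelˡ-≤ (length X) (length zs) (length ds) (begin
      length X + length zs    ≡⟨ length-++ X ⟨
      length (X ++ zs)        ≤⟨ hall (X ++ zs) (cs ∪ ds) !X++zs X++zs⊆vs !cs∪ds covers′ ⟩
      length (cs ∪ ds)        ≤⟨ length-∪ cs ds ⟩
      length cs + length ds   ≤⟨ +-monoˡ-≤ (length ds) tight ⟩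
      length X + length ds    ∎)
    where
      open ≤-Reasoning
      cs : List ℕ
      cs = colours L X
      ∉X? : Decidable (_∉ X)
      ∉X? w = ¬? (w ∈? X)
      zs∌X : ∀ {z} → z ∈ zs → z ∉ X
      zs∌X z∈zs = proj₂ (∈-filter⁻ ∉X? {xs = vs} (zs⊆vs∖X z∈zs))
      !X++zs : Unique (X ++ zs)
      !X++zs = Unique.++⁺ !X !zs λ (z∈X , z∈zs) → zs∌X z∈zs z∈X
      X++zs⊆vs : X ++ zs ⊆ vs
      X++zs⊆vs w∈ with ∈-++⁻ X w∈
      ... | inj₁ w∈X = X⊆vs w∈X
      ... | inj₂ w∈zs = proj₁ (∈-filter⁻ ∉X? {xs = vs} (zs⊆vs∖X w∈zs))
      !cs∪ds : Unique (cs ∪ ds)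
      !cs∪ds = Unique-∪ (Unique-colours L X) !ds
      covers′ : Covers L (X ++ zs) (cs ∪ ds)
      covers′ w∈ with ∈-++⁻ X w∈
      ... | inj₁ w∈X = λ d∈ → ∈-∪⁺ {l = ds} (inj₁ (∈-colours⁺ w∈X d∈))
      ... | inj₂ w∈zs = avoiding⊆⇒⊆∪ cs (covers w∈zs)

  SDRsUpTo : ℕ → Set
  SDRsUpTo n = ∀ {L vs} → length vs ≤ n → Unique vs → HallCondition L vs → SDR L vs

  sdr-colouring-first : ∀ {n L v vs} → SDRsUpTo n → length vs ≤ n → Unique (v ∷ vs) →
    HallCondition L (v ∷ vs) → ¬ Any (Critical L (v ∷ vs)) (sublists (v ∷ vs)) → SDR L (v ∷ vs)
  sdr-colouring-first {L = L} {v} {vs} sdrs len (v∉vs ∷ !vs) hall noCritical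
    with c , c∈Lv ← hall⇒nonempty hall (here refl) =
    colouring-glue (_≟ v) [ c ] σv (λ _ _ → here refl) σrest
    where
      σv : Colouring _≢_ L (λ w → w ∈ v ∷ vs × w ≡ v)
      σv = const c , (λ { (_ , refl) → c∈Lv }) , λ { (_ , refl) (_ , refl) v≢v → ⊥-elim (v≢v refl) }
      σrest : Colouring _≢_ (avoiding [ c ] ∘ L) (λ w → w ∈ v ∷ vs × w ≢ v)
      σrest = colouring-mono (λ { (here w≡v , w≢v) → ⊥-elim (w≢v w≡v) ; (there w∈vs , _) → w∈vs }) id
        (sdrs len !vs (hall-avoiding-colour c (λ v∈vs → All.lookup v∉vs v∈vs refl) hall noCritical))

  sdr-split-critical : ∀ {n L vs} → SDRsUpTo n → length vs ≤ suc n → Unique vs →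
    HallCondition L vs → Any (Critical L vs) (sublists vs) → SDR L vs
  sdr-split-critical {L = L} {vs} sdrs len !vs hall critical
    with X , X∈ , (0<∣X∣ , ∣X∣<∣vs∣ , tight) ← find critical =
    colouring-glue (_∈? X) (colours L X)
      (colouring-mono proj₂ id σX) (λ _ w∈X → ∈-colours⁺ w∈X (proj₁ (proj₂ σX) w∈X))
      (colouring-mono (λ (w∈vs , w∉X) → ∈-filter⁺ (λ w → ¬? (w ∈? X)) w∈vs w∉X) id σrest)
    where
      X⊆vs : X ⊆ vs
      X⊆vs = sublists-⊆ vs X∈
      !X : Unique X
      !X = Unique-sublists !vs X∈
      σX : SDR L X
      σX = sdrs (≤-pred (<-≤-trans ∣X∣<∣vs∣ len)) !X (HallCondition-⊆ X⊆vs hall)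
      σrest : SDR (avoiding (colours L X) ∘ L) (vs ∖ X)
      σrest = sdrs (≤-pred (<-≤-trans (length-∖ X⊆vs 0<∣X∣) len))
        (Unique.filter⁺ (λ w → ¬? (w ∈? X)) !vs) (hall-avoiding-critical !X X⊆vs tight hall)

  sdr-unique : ∀ n → SDRsUpTo n
  sdr-unique _ {vs = []} _ _ _ = const 0 , (λ ()) , λ ()
  sdr-unique (suc n) {L} {v ∷ vs} len !vs hall with any? (critical? L (v ∷ vs)) (sublists (v ∷ vs))
  ... | yes critical = sdr-split-critical (sdr-unique n) len !vs hall critical
  ... | no noCritical = sdr-colouring-first (sdr-unique n) (≤-pred len) !vs hall noCritical

  hall-theorem : ∀ {L vs} → HallCondition L vs → SDR L vs
  hall-theorem {L} {vs} hall = colouring-mono (∈-deduplicate⁺ _≟_) id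
    (sdr-unique _ ≤-refl (deduplicate-! vs) (HallCondition-⊆ (∈-deduplicate⁻ _≟_ vs) hall))

module CocktailParty {A : Set} (_≟_ : DecidableEquality A) where
  open Hall _≟_
  open import Data.List.Membership.DecPropositional _≟_ using (_∈?_)

  _≟²_ : DecidableEquality (A × A)
  _≟²_ = ≡-dec _≟_ _≟_

  vertices : List (A × A) → List A
  vertices [] = []
  vertices ((x , y) ∷ ps) = x ∷ y ∷ vertices ps

  Mate : List (A × A) → A → A → Set
  Mate ps v w = (v , w) ∈ ps ⊎ (w , v) ∈ ps

  Conflict : List (A × A) → A → A → Set
  Conflict ps v w = v ≢ w × ¬ Mate ps v w

  PairColouring : List (A × A) → (A → List ℕ) → Set
  PairColouring ps L = Colouring (Conflict ps) L (_∈ vertices ps)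

  LongLists : List (A × A) → (A → List ℕ) → Set
  LongLists ps L = ∀ {v} → v ∈ vertices ps → Unique (L v) × length ps ≤ length (L v)

  EndOf : A → A × A → Set
  EndOf v (x , y) = v ≡ x ⊎ v ≡ y

  endOf? : ∀ v p → Dec (EndOf v p)
  endOf? v (x , y) = (v ≟ x) ⊎-dec (v ≟ y)

  ∈-vertices⁻ : ∀ ps {v} → v ∈ vertices ps → ∃ λ p → p ∈ ps × EndOf v p
  ∈-vertices⁻ ((x , y) ∷ ps) (here v≡x) = (x , y) , here refl , inj₁ v≡x
  ∈-vertices⁻ ((x , y) ∷ ps) (there (here v≡y)) = (x , y) , here refl , inj₂ v≡y
  ∈-vertices⁻ ((x , y) ∷ ps) (there (there v∈)) with p , p∈ , end ← ∈-vertices⁻ ps v∈ =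
    p , there p∈ , end

  ∈-vertices⁺ : ∀ ps {v p} → p ∈ ps → EndOf v p → v ∈ vertices ps
  ∈-vertices⁺ ((x , y) ∷ ps) (here refl) (inj₁ v≡x) = here v≡x
  ∈-vertices⁺ ((x , y) ∷ ps) (here refl) (inj₂ v≡y) = there (here v≡y)
  ∈-vertices⁺ ((x , y) ∷ ps) (there p∈) end = there (there (∈-vertices⁺ ps p∈ end))

  vertices-⊆ : ∀ {qs ps} → qs ⊆ ps → vertices qs ⊆ vertices ps
  vertices-⊆ {qs} {ps} qs⊆ps v∈ with p , p∈ , end ← ∈-vertices⁻ qs v∈ = ∈-vertices⁺ ps (qs⊆ps p∈) end

  length-vertices : ∀ ps → length (vertices ps) ≤ length ps + length ps
  length-vertices [] = z≤n
  length-vertices (_ ∷ ps) = s≤s (≤-trans (s≤s (length-vertices ps)) (≤-reflexive (sym (+-suc _ _))))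

  pairOf : List (A × A) → A → A × A
  pairOf [] v = v , v
  pairOf (p ∷ ps) v with endOf? v p
  ... | yes _ = p
  ... | no _ = pairOf ps v

  pairOf-spec : ∀ ps {v} → v ∈ vertices ps → pairOf ps v ∈ ps × EndOf v (pairOf ps v)
  pairOf-spec ((x , y) ∷ ps) {v} v∈ with endOf? v (x , y) | v∈
  ... | yes end | _ = here refl , end
  ... | no ¬end | here v≡x = ⊥-elim (¬end (inj₁ v≡x))
  ... | no ¬end | there (here v≡y) = ⊥-elim (¬end (inj₂ v≡y))
  ... | no _    | there (there v∈′) = map₁ there (pairOf-spec ps v∈′)

  BothEndsIn : List A → A × A → Set
  BothEndsIn xs (x , y) = x ∈ xs × y ∈ xs

  length≤#pairs : ∀ ps {xs} → Unique xs → xs ⊆ vertices ps → ¬ Any (BothEndsIn xs) ps →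
    length xs ≤ length ps
  length≤#pairs ps {xs} !xs xs⊆ noBoth = begin
    length xs                 ≡⟨ length-map (pairOf ps) xs ⟨
    length (map (pairOf ps) xs) ≤⟨ Unique-⊆⇒length≤ _≟²_ !pairs pairs⊆ps ⟩
    length ps                 ∎
    where
      open ≤-Reasoning
      both : ∀ {u w p} → u ∈ xs → w ∈ xs → u ≢ w → EndOf u p → EndOf w p → BothEndsIn xs p
      both u∈ w∈ u≢w (inj₁ refl) (inj₁ refl) = ⊥-elim (u≢w refl)
      both u∈ w∈ u≢w (inj₁ refl) (inj₂ refl) = u∈ , w∈
      both u∈ w∈ u≢w (inj₂ refl) (inj₁ refl) = w∈ , u∈
      both u∈ w∈ u≢w (inj₂ refl) (inj₂ refl) = ⊥-elim (u≢w refl)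
      !pairs : Unique (map (pairOf ps) xs)
      !pairs = Unique-map⁺-injectiveOn (pairOf ps) !xs λ {u} {w} u∈ w∈ u≢w same →
        let p∈ , u-end = pairOf-spec ps (xs⊆ u∈)
            _ , w-end = pairOf-spec ps (xs⊆ w∈)
        in noBoth (lose p∈ (both u∈ w∈ u≢w u-end (subst (EndOf w) (sym same) w-end)))
      pairs⊆ps : map (pairOf ps) xs ⊆ ps
      pairs⊆ps p∈ with u , u∈ , refl ← ∈-map⁻ (pairOf ps) p∈ = proj₁ (pairOf-spec ps (xs⊆ u∈))

  disjoint-pairs⇒hall : ∀ {ps L} → LongLists ps L →
    (∀ {x y} → (x , y) ∈ ps → Disjoint (L x) (L y)) → HallCondition L (vertices ps)
  disjoint-pairs⇒hall {ps} {L} long disjoint xs cs !xs xs⊆ !cs covers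
    with any? (λ (x , y) → (x ∈? xs) ×-dec (y ∈? xs)) ps
  ... | yes both with (x , y) , p∈ , x∈xs , y∈xs ← find both = begin
    length xs                   ≤⟨ Unique-⊆⇒length≤ _≟_ !xs xs⊆ ⟩
    length (vertices ps)        ≤⟨ length-vertices ps ⟩
    length ps + length ps       ≤⟨ +-mono-≤ (proj₂ (long x∈)) (proj₂ (long y∈)) ⟩
    length (L x) + length (L y) ≡⟨ length-++ (L x) ⟨
    length (L x ++ L y)         ≤⟨ Unique-⊆⇒length≤ _≟ℕ_ !Lx++Ly Lx++Ly⊆cs ⟩
    length cs                   ∎
    where
      open ≤-Reasoning
      x∈ : x ∈ vertices ps
      x∈ = ∈-vertices⁺ ps p∈ (inj₁ refl)
      y∈ : y ∈ vertices ps
      y∈ = ∈-vertices⁺ ps p∈ (inj₂ refl)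
      !Lx++Ly : Unique (L x ++ L y)
      !Lx++Ly = Unique.++⁺ (proj₁ (long x∈)) (proj₁ (long y∈)) (disjoint p∈)
      Lx++Ly⊆cs : L x ++ L y ⊆ cs
      Lx++Ly⊆cs d∈ with ∈-++⁻ (L x) d∈
      ... | inj₁ d∈Lx = covers x∈xs d∈Lx
      ... | inj₂ d∈Ly = covers y∈xs d∈Ly
  disjoint-pairs⇒hall {ps} {L} long disjoint [] cs _ _ _ _ | no _ = z≤n
  disjoint-pairs⇒hall {ps} {L} long disjoint xs@(x ∷ _) cs !xs xs⊆ !cs covers | no noBoth = begin
    length xs      ≤⟨ length≤#pairs ps !xs xs⊆ noBoth ⟩
    length ps      ≤⟨ proj₂ (long (xs⊆ (here refl))) ⟩
    length (L x)   ≤⟨ Unique-⊆⇒length≤ _≟ℕ_ (proj₁ (long (xs⊆ (here refl)))) (covers (here refl)) ⟩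
    length cs      ∎
    where open ≤-Reasoning

  Common : (A → List ℕ) → A × A → Set
  Common L (x , y) = Any (_∈ L y) (L x)

  common? : ∀ L p → Dec (Common L p)
  common? L (x , y) = any? (λ c → c ∈ℕ? L y) (L x)

  PairColouringsUpTo : ℕ → Set
  PairColouringsUpTo n = ∀ {ps L} → length ps ≤ n → LongLists ps L → PairColouring ps L

  pair-colouring-common : ∀ {n ps L} → PairColouringsUpTo n → length ps ≤ suc n → LongLists ps L →
    Any (Common L) ps → PairColouring ps L
  pair-colouring-common {n} {ps} {L} colourings len long common
    with (x , y) , p∈ , shared ← find common
    with c , c∈Lx , c∈Ly ← find shared =
    colouring-glue (λ w → endOf? w (x , y)) [ c ] σp (λ _ _ → here refl)
      (colouring-mono rest-domain (map₂ (_∘ mate-rest⇒mate)) (colourings len′ long′))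
    where
      rest : List (A × A)
      rest = filter (λ q → ¬? (q ≟² (x , y))) ps
      rest⊆ps : rest ⊆ ps
      rest⊆ps q∈ = proj₁ (∈-filter⁻ (λ q → ¬? (q ≟² (x , y))) {xs = ps} q∈)
      mate-rest⇒mate : ∀ {v w} → Mate rest v w → Mate ps v w
      mate-rest⇒mate = ⊎-map rest⊆ps rest⊆ps
      σp : Colouring (Conflict ps) L (λ w → w ∈ vertices ps × EndOf w (x , y))
      σp = const c , (λ { (_ , inj₁ refl) → c∈Lx ; (_ , inj₂ refl) → c∈Ly }) , proper
        where
          proper : ∀ {v w} → v ∈ vertices ps × EndOf v (x , y) → w ∈ vertices ps × EndOf w (x , y) →
            Conflict ps v w → c ≢ c
          proper (_ , inj₁ refl) (_ , inj₁ refl) (v≢w , _) = ⊥-elim (v≢w refl)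
          proper (_ , inj₁ refl) (_ , inj₂ refl) (_ , ¬mate) = ⊥-elim (¬mate (inj₁ p∈))
          proper (_ , inj₂ refl) (_ , inj₁ refl) (_ , ¬mate) = ⊥-elim (¬mate (inj₂ p∈))
          proper (_ , inj₂ refl) (_ , inj₂ refl) (v≢w , _) = ⊥-elim (v≢w refl)
      rest-domain : ∀ {w} → w ∈ vertices ps × ¬ EndOf w (x , y) → w ∈ vertices rest
      rest-domain (w∈ , ¬end) with q , q∈ , end ← ∈-vertices⁻ ps w∈ with q ≟² (x , y)
      ... | yes refl = ⊥-elim (¬end end)
      ... | no q≢p = ∈-vertices⁺ rest (∈-filter⁺ (λ q → ¬? (q ≟² (x , y))) q∈ q≢p) end
      ∣rest∣<∣ps∣ : length rest < length ps
      ∣rest∣<∣ps∣ = filter-notAll _ ps (lose p∈ λ p≢p → p≢p refl)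
      len′ : length rest ≤ n
      len′ = ≤-pred (<-≤-trans ∣rest∣<∣ps∣ len)
      long′ : LongLists rest (avoiding [ c ] ∘ L)
      long′ v∈ =
        let !Lv , ∣ps∣≤∣Lv∣ = long (vertices-⊆ rest⊆ps v∈)
        in Unique.filter⁺ _ !Lv
         , ≤-pred (≤-trans (<-≤-trans ∣rest∣<∣ps∣ ∣ps∣≤∣Lv∣) (length≤1+avoiding c !Lv))

  pair-colouring : ∀ n → PairColouringsUpTo n
  pair-colouring _ {[]} _ _ = const 0 , (λ ()) , λ ()
  pair-colouring (suc n) {ps} {L} len long with any? (common? L) ps
  ... | yes common = pair-colouring-common (pair-colouring n) len long common
  ... | no noCommon = colouring-mono id proj₁ (hall-theorem (disjoint-pairs⇒hall long disjoint))
    where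
      disjoint : ∀ {x y} → (x , y) ∈ ps → Disjoint (L x) (L y)
      disjoint p∈ (d∈Lx , d∈Ly) = noCommon (lose p∈ (lose d∈Lx d∈Ly))

  cocktail-party-choosable : ∀ {ps L} → LongLists ps L → PairColouring ps L
  cocktail-party-choosable = pair-colouring _ ≤-refl

-- (v , u) stands for the incidence (v , vu).
Arc : Set
Arc = Fin 4 × Fin 4

_≟Arc_ : DecidableEquality Arc
_≟Arc_ = ≡-dec _≟F_ _≟F_

open CocktailParty _≟Arc_
open import Data.List.Membership.DecPropositional _≟Arc_ using () renaming (_∈?_ to _∈Arc?_)

pairing : List (Arc × Arc)
pairing = ((# 0 , # 1) , (# 2 , # 3)) ∷ ((# 1 , # 0) , (# 3 , # 2))
        ∷ ((# 0 , # 2) , (# 1 , # 3)) ∷ ((# 2 , # 0) , (# 3 , # 1))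
        ∷ ((# 0 , # 3) , (# 1 , # 2)) ∷ ((# 3 , # 0) , (# 2 , # 1)) ∷ []

-- AdjInc never inspects the adjacency proofs, so on K₄ it is this relation on arcs.
ArcsAdjacent : Arc → Arc → Set
ArcsAdjacent (v , u) (w , x) = v ≡ w ⊎ SameEdge v u w x ⊎ SameEdge v w v u ⊎ SameEdge v w w x

sameEdge? : ∀ (v u w x : Fin 4) → Dec (SameEdge v u w x)
sameEdge? v u w x = ((v ≟F w) ×-dec (u ≟F x)) ⊎-dec ((v ≟F x) ×-dec (u ≟F w))

arcsAdjacent? : ∀ a b → Dec (ArcsAdjacent a b)
arcsAdjacent? (v , u) (w , x) =
  (v ≟F w) ⊎-dec sameEdge? v u w x ⊎-dec sameEdge? v w v u ⊎-dec sameEdge? v w w x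

arcs∈pairing : ∀ v u → v ≡ u ⊎ (v , u) ∈ vertices pairing
arcs∈pairing =
  toWitness {a? = allFin? λ v → allFin? λ u → (v ≟F u) ⊎-dec ((v , u) ∈Arc? vertices pairing)} _

loops∉pairing : All (λ (v , u) → v ≢ u) (vertices pairing)
loops∉pairing = toWitness {a? = All.all? (λ (v , u) → ¬? (v ≟F u)) (vertices pairing)} _

pairs-nonadjacent : All (λ (a , b) → ¬ ArcsAdjacent a b × ¬ ArcsAdjacent b a) pairing
pairs-nonadjacent =
  toWitness {a? = All.all? (λ (a , b) → ¬? (arcsAdjacent? a b) ×-dec ¬? (arcsAdjacent? b a)) pairing} _

mates-nonadjacent : ∀ {a b} → Mate pairing a b → ¬ ArcsAdjacent a b
mates-nonadjacent (inj₁ m) = proj₁ (All.lookup pairs-nonadjacent m)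
mates-nonadjacent (inj₂ m) = proj₂ (All.lookup pairs-nonadjacent m)

arcLists : ∀ {k} → ListAssignment K₄ k → Arc → List ℕ
arcLists L (v , u) with v ≟F u
... | yes _ = []
... | no v≢u = tabulate (proj₁ (L (v , u , v≢u)))

-- The proof of v ≢ u produced by _≟F_ is definitionally equal to the given one, as ⊥ is
-- proof-irrelevant in the standard library.
∈-arcLists⁻ : ∀ {k} (L : ListAssignment K₄ k) {v u c} (v≢u : v ≢ u) →
  c ∈ arcLists L (v , u) → InList {G = K₄} L (v , u , v≢u) c
∈-arcLists⁻ L {v} {u} v≢u c∈ with v ≟F u
... | yes v≡u = ⊥-elim (v≢u v≡u)
... | no _ with j , c≡ ← ∈-tabulate⁻ c∈ = j , sym c≡

arcLists-long : ∀ {k} → 6 ≤ k → (L : ListAssignment K₄ k) → LongLists pairing (arcLists L)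
arcLists-long 6≤k L {v , u} a∈ with v ≟F u
... | yes v≡u = ⊥-elim (All.lookup loops∉pairing a∈ v≡u)
... | no v≢u = Unique.tabulate⁺ (proj₂ (L (v , u , v≢u)))
            , subst (6 ≤_) (sym (length-tabulate (proj₁ (L (v , u , v≢u))))) 6≤k

K₄-incidence-choosable : ∀ {k} → 6 ≤ k → IncChoosable K₄ k
K₄-incidence-choosable 6≤k L with σ , σ∈L , proper ← cocktail-party-choosable (arcLists-long 6≤k L) =
  σᵢ , inList , properᵢ
  where
    σᵢ : Incidence K₄ → ℕ
    σᵢ (v , u , _) = σ (v , u)
    arc∈ : ∀ {v u} → v ≢ u → (v , u) ∈ vertices pairing
    arc∈ {v} {u} v≢u with arcs∈pairing v u
    ... | inj₁ v≡u = ⊥-elim (v≢u v≡u)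
    ... | inj₂ a∈ = a∈
    inList : ∀ i → InList {G = K₄} L i (σᵢ i)
    inList (v , u , v≢u) = ∈-arcLists⁻ L v≢u (σ∈L (arc∈ v≢u))
    properᵢ : ∀ i j → AdjInc {G = K₄} i j →
      ¬ (vtx {G = K₄} i ≡ vtx {G = K₄} j × other {G = K₄} i ≡ other {G = K₄} j) → σᵢ i ≢ σᵢ j
    properᵢ (v , u , v≢u) (w , x , w≢x) adjacent distinct = proper (arc∈ v≢u) (arc∈ w≢x)
      ( (λ arcs≡ → distinct (cong proj₁ arcs≡ , cong proj₂ arcs≡))
      , (λ mate → mates-nonadjacent mate adjacent) )

lemma13 : chᵢ≤ K₄ 6
lemma13 = 6 , ≤-refl , K₄-incidence-choosable ≤-refl
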